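{- If $T$ is a tree, then $T$ is ${\cal N}$ for the Maker-Breaker total domination game if $T=K_{1,n}$ with $n\ge 2$, and otherwise $T$ is ${\cal S}$.
   Context: The Maker-Breaker total domination game on a graph is played by Dominator and Staller, who alternately select a vertex not selected before. Dominator wins if at some point the set of vertices he has selected is a total dominating set (every vertex has a neighbour in it); otherwise Staller wins. A graph is ${\cal S}$ if Staller has a winning strategy regardless of who moves first, and ${\cal N}$ if the player who moves first has a winning strategy. -}

module Defs where

open import Data.Nat using (ℕ; zero; suc; _≤_; _+_)
open import Data.Fin using (Fin; zero; suc)
open import Data.Fin.Properties using (_≟_)
open import Data.List using (List; []; _∷_; length)
open import Data.List.Relation.Unary.Unique.Propositional using (Unique)
open import Data.Product using (Σ; ∃; ∃-syntax; _×_; _,_)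
open import Data.Sum using (_⊎_)
open import Data.Empty using (⊥)
open import Data.Unit using (⊤)
open import Relation.Nullary using (¬_; yes; no)
open import Relation.Binary.PropositionalEquality using (_≡_; _≢_)
open import Function.Bundles using (_↔_; Inverse)

record Graph : Set₁ where
  field
    n     : ℕ
    Adj   : Fin n → Fin n → Set
    sym   : ∀ {u v} → Adj u v → Adj v u
    irrefl : ∀ {u} → ¬ Adj u u
open Graph public

data Walk (G : Graph) : Fin (n G) → Fin (n G) → Set where
  here : ∀ {u} → Walk G u u
  step : ∀ {u w v} → Adj G u w → Walk G w v → Walk G u v

Connected : Graph → Set
Connected G = ∀ u v → Walk G u v

data Chain (G : Graph) : List (Fin (n G)) → Set where
  []  : Chain G []
  [-] : ∀ {u} → Chain G (u ∷ [])
  _∷_ : ∀ {u v vs} → Adj G u v → Chain G (v ∷ vs) → Chain G (u ∷ v ∷ vs)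

-- A cycle: at least 3 distinct vertices v₀ … vₖ, consecutive ones adjacent, vₖ adjacent to v₀.
record Cycle (G : Graph) : Set where
  field
    first : Fin (n G)
    rest  : List (Fin (n G))
    lastV : Fin (n G)
    long  : 1 ≤ length rest
    uniq  : Unique (first ∷ Data.List._++_ rest (lastV ∷ []))
    chain : Chain G (first ∷ Data.List._++_ rest (lastV ∷ []))
    close : Adj G lastV first

IsTree : Graph → Set
IsTree G = (1 ≤ n G) × Connected G × ¬ Cycle G

StarAdj : ∀ {k} → Fin k → Fin k → Set
StarAdj zero    zero    = ⊥
StarAdj zero    (suc _) = ⊤
StarAdj (suc _) zero    = ⊤
StarAdj (suc _) (suc _) = ⊥

starSym : ∀ {k} {u v : Fin k} → StarAdj u v → StarAdj v u
starSym {u = zero}  {suc _} p = p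
starSym {u = suc _} {zero}  p = p

starIrr : ∀ {k} {u : Fin k} → ¬ StarAdj u u
starIrr {u = zero} ()
starIrr {u = suc _} ()

Star : ℕ → Graph
Star m = record { n = suc m ; Adj = StarAdj ; sym = starSym ; irrefl = starIrr }

_≅_ : Graph → Graph → Set
G ≅ H = Σ (Fin (n G) ↔ Fin (n H)) λ f →
          ∀ u v → (Adj G u v → Adj H (Inverse.to f u) (Inverse.to f v))
                × (Adj H (Inverse.to f u) (Inverse.to f v) → Adj G u v)

data Owner : Set where
  free dom stal : Owner

data Player : Set where
  Dominator Staller : Player

Position : Graph → Set
Position G = Fin (n G) → Owner

start : (G : Graph) → Position G
start G _ = free

set : {G : Graph} → Position G → Fin (n G) → Owner → Position G
set p v o w with w ≟ v
... | yes _ = o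
... | no  _ = p w

TotDom : (G : Graph) → Position G → Set
TotDom G p = ∀ u → ∃[ w ] (Adj G u w × p w ≡ dom)

data DWins (G : Graph) : Position G → Player → Set where
  done  : ∀ {p pl} → TotDom G p → DWins G p pl
  dmove : ∀ {p} v → p v ≡ free → DWins G (set {G} p v dom) Staller → DWins G p Dominator
  smove : ∀ {p} → (∃[ v ] p v ≡ free) →
          (∀ v → p v ≡ free → DWins G (set {G} p v stal) Dominator) → DWins G p Staller

data SWins (G : Graph) : Position G → Player → Set where
  over  : ∀ {p pl} → ¬ TotDom G p → (∀ v → p v ≢ free) → SWins G p pl
  smove : ∀ {p} → ¬ TotDom G p → ∀ v → p v ≡ free →
          SWins G (set {G} p v stal) Dominator → SWins G p Staller
  dmove : ∀ {p} → ¬ TotDom G p → (∃[ v ] p v ≡ free) →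
          (∀ v → p v ≡ free → SWins G (set {G} p v dom) Staller) → SWins G p Dominator

IsN : Graph → Set
IsN G = DWins G (start G) Dominator × SWins G (start G) Staller

IsS : Graph → Set
IsS G = SWins G (start G) Dominator × SWins G (start G) Staller

IsLargeStar : Graph → Set
IsLargeStar G = ∃[ m ] (2 ≤ m × G ≅ Star m)

-- A vertex whose neighbours all belong to Staller can never be totally dominated, so Staller wins
-- as soon as she owns a vertex's whole neighbourhood. In a tree that is not a large star,
-- whichever vertex v Dominator claims first (any v if Staller starts), the far end of a maximal
-- path leaving v through a non-leaf neighbour is a leaf whose neighbour s differs from v (if all
-- neighbours of v are leaves, the tree is K₁, K₂ or a large star); Staller claims s. In K_{1,n}
-- with n ≥ 2, Staller moving first claims the centre, cutting off every leaf; Dominator moving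
-- first claims the centre and then a leaf Staller did not take, and these two vertices totally
-- dominate the star.
module Submission where

open import Defs
open import Data.Nat using (zero; suc; _≤_; z≤n; s≤s)
open import Data.Nat.Properties using (≤-refl; ≤-trans; n≤1+n)
open import Data.Fin using (Fin; zero; suc; punchOut; fromℕ<)
open import Data.Fin.Properties using (_≟_; any?; punchOut-injective)
open import Data.Fin.Permutation using (transpose)
open import Data.Fin.Subset as Subset using (Subset; _⊂_; _-_; ⊤)
open import Data.Fin.Subset.Properties using (∈⊤; x∈p⇒p-x⊂p; x∈p∧x≢y⇒x∈p-y)
open import Data.Fin.Subset.Induction using (⊂-wellFounded)
open import Data.List using (List; []; _∷_; _++_; [_]; length)
open import Data.List.Properties using (++-assoc)
open import Data.List.Relation.Unary.All as All using ([])
open import Data.List.Relation.Unary.All.Properties using (¬Any⇒All¬; ++⁻ˡ)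
open import Data.List.Relation.Unary.AllPairs using ([]; _∷_)
open import Data.List.Relation.Unary.Any as Any using (here; there)
open import Data.List.Relation.Unary.Unique.Propositional using (Unique)
open import Data.List.Membership.Propositional using (_∈_; _∉_)
open import Data.List.Membership.Propositional.Properties using (∈-∃++; ∈-++⁻; ∈-++⁺ʳ)
open import Data.Product using (∃; ∃₂; _×_; _,_; proj₁; proj₂)
import Data.Product as Product
open import Data.Sum using (_⊎_; inj₁; inj₂)
import Data.Sum as Sum
open import Data.Unit using (tt)
open import Function using (_∘_; case_of_)
open import Function.Bundles using (_⇔_; _↔_; mk⇔; Inverse; Injection; Equivalence)
open import Function.Construct.Composition using (_⇔-∘_)
open import Function.Construct.Symmetry using (⇔-sym; ↔-sym)
open import Function.Definitions using (Injective)
open import Function.Properties.Inverse using (↔⇒↣)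
open import Induction.WellFounded using (Acc; acc)
open import Relation.Nullary using (¬_; Dec; yes; no; ¬?; contradiction)
open import Relation.Nullary.Decidable using (_×-dec_; decidable-stable)
open import Relation.Binary.PropositionalEquality using (_≡_; _≢_; refl; trans; cong; subst; ≢-sym)
import Relation.Binary.PropositionalEquality as ≡

Adj⇒≢ : (G : Graph) → ∀ {u v} → Adj G u v → u ≢ v
Adj⇒≢ G uv refl = irrefl G uv

SoleNeighbour : (G : Graph) → Fin (n G) → Fin (n G) → Set
SoleNeighbour G ℓ s = ∀ w → Adj G ℓ w → w ≡ s

IsPath : (G : Graph) → List (Fin (n G)) → Set
IsPath G xs = Chain G xs × Unique xs

Unique-++⁻ˡ : ∀ {A : Set} (xs : List A) {ys} → Unique (xs ++ ys) → Unique xs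
Unique-++⁻ˡ []       _             = []
Unique-++⁻ˡ (x ∷ xs) (x∉ ∷ unique) = ++⁻ˡ xs x∉ ∷ Unique-++⁻ˡ xs unique

Unique-++⁻ʳ : ∀ {A : Set} (xs : List A) {ys} → Unique (xs ++ ys) → Unique ys
Unique-++⁻ʳ []       unique       = unique
Unique-++⁻ʳ (x ∷ xs) (_ ∷ unique) = Unique-++⁻ʳ xs unique

module _ {G : Graph} where

  Chain-tail : ∀ {x xs} → Chain G (x ∷ xs) → Chain G xs
  Chain-tail [-]     = []
  Chain-tail (_ ∷ c) = c

  Chain-++⁻ˡ : ∀ xs {ys} → Chain G (xs ++ ys) → Chain G xs
  Chain-++⁻ˡ []           _        = []
  Chain-++⁻ˡ (x ∷ [])     _        = [-]
  Chain-++⁻ˡ (x ∷ y ∷ xs) (xy ∷ c) = xy ∷ Chain-++⁻ˡ (y ∷ xs) c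

  Chain-++⁻ʳ : ∀ xs {ys} → Chain G (xs ++ ys) → Chain G ys
  Chain-++⁻ʳ []       c = c
  Chain-++⁻ʳ (x ∷ xs) c = Chain-++⁻ʳ xs (Chain-tail c)

  IsPath-++⁻ˡ : ∀ xs {ys} → IsPath G (xs ++ ys) → IsPath G xs
  IsPath-++⁻ˡ xs = Product.map (Chain-++⁻ˡ xs) (Unique-++⁻ˡ xs)

  IsPath-++⁻ʳ : ∀ xs {ys} → IsPath G (xs ++ ys) → IsPath G ys
  IsPath-++⁻ʳ xs = Product.map (Chain-++⁻ʳ xs) (Unique-++⁻ʳ xs)

  IsPath-∷ : ∀ {x y ys} → Adj G x y → x ∉ y ∷ ys → IsPath G (y ∷ ys) → IsPath G (x ∷ y ∷ ys)
  IsPath-∷ xy x∉ (chain , unique) = xy ∷ chain , ¬Any⇒All¬ _ x∉ ∷ unique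

  chord⇒Cycle : ∀ {u y x rest} → IsPath G (u ∷ y ∷ rest) → x ∈ rest → Adj G x u → Cycle G
  chord⇒Cycle {u} {y} {x} path x∈rest xu with ∈-∃++ x∈rest
  ... | as , bs , refl = record
    { first = u ; rest = y ∷ as ; lastV = x ; long = s≤s z≤n
    ; uniq = proj₂ prefix ; chain = proj₁ prefix ; close = xu }
    where
    prefix : IsPath G (u ∷ y ∷ as ++ [ x ])
    prefix = IsPath-++⁻ˡ (u ∷ y ∷ as ++ [ x ])
      (subst (IsPath G) (cong (λ l → u ∷ y ∷ l) (≡.sym (++-assoc as [ x ] bs))) path)

  ∈path⇒path : ∀ {u v} xs → IsPath G (xs ++ [ v ]) → u ∈ xs ++ [ v ] →
    u ≡ v ⊎ ∃ λ L → IsPath G (u ∷ L ++ [ v ])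
  ∈path⇒path {u} {v} xs path u∈ with ∈-++⁻ xs u∈
  ... | inj₂ (here refl) = inj₁ refl
  ... | inj₁ u∈xs with ∈-∃++ u∈xs
  ...   | as , bs , refl = inj₂ (bs , IsPath-++⁻ʳ as (subst (IsPath G) (++-assoc as (u ∷ bs) [ v ]) path))

  walk⇒path : ∀ {u v} → Walk G u v → u ≡ v ⊎ ∃ λ L → IsPath G (u ∷ L ++ [ v ])
  walk⇒path here = inj₁ refl
  walk⇒path {u} {v} (step {w = w} uw walk) with walk⇒path walk
  ... | inj₁ refl = inj₂ ([] , IsPath-∷ uw (λ { (here refl) → irrefl G uw ; (there ()) }) ([-] , [] ∷ []))
  ... | inj₂ (L , path) with Any.any? (u ≟_) (w ∷ L ++ [ v ])
  ...   | no u∉  = inj₂ (w ∷ L , IsPath-∷ uw u∉ path)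
  ...   | yes u∈ = ∈path⇒path (w ∷ L) path u∈

  acyclic⇒decAdj : Connected G → ¬ Cycle G → ∀ u v → Dec (Adj G u v)
  acyclic⇒decAdj connected acyclic u v with walk⇒path (connected u v)
  ... | inj₁ refl              = no (irrefl G)
  ... | inj₂ ([] , uv ∷ _ , _) = yes uv
  ... | inj₂ (y ∷ L , path)    =
    no λ uv → acyclic (chord⇒Cycle path (∈-++⁺ʳ L (here refl)) (sym G uv))

  -- U contains every vertex off the path, so it shrinks strictly with each extension.
  extendToMaximal : (∀ u v → Dec (Adj G u v)) → ∀ {u L v} (U : Subset (n G)) → Acc _⊂_ U →
    (∀ x → x ∉ u ∷ L ++ [ v ] → x Subset.∈ U) → IsPath G (u ∷ L ++ [ v ]) →
    ∃₂ λ u′ L′ → IsPath G (u′ ∷ L′ ++ [ v ]) × length L ≤ length L′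
               × (∀ x → Adj G u′ x → x ∈ u′ ∷ L′ ++ [ v ])
  extendToMaximal adj? {u} {L} {v} U (acc smaller) off⊆U path
    with any? (λ x → adj? u x ×-dec ¬? (Any.any? (x ≟_) (u ∷ L ++ [ v ])))
  ... | yes (x , ux , x∉) =
    let u′ , L′ , path′ , length≤ , maximal =
          extendToMaximal adj? (U - x) (smaller (x∈p⇒p-x⊂p (off⊆U x x∉)))
            (λ y y∉ → x∈p∧x≢y⇒x∈p-y (off⊆U y (y∉ ∘ there)) (y∉ ∘ here))
            (IsPath-∷ (sym G ux) x∉ path)
    in u′ , L′ , path′ , ≤-trans (n≤1+n _) length≤ , maximal
  ... | no none = u , L , path , ≤-refl ,
    λ x ux → decidable-stable (Any.any? (x ≟_) _) (λ x∉ → none (x , ux , x∉))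

  maximal⇒soleNeighbour : ¬ Cycle G → ∀ {u y rest} → IsPath G (u ∷ y ∷ rest) →
    (∀ x → Adj G u x → x ∈ u ∷ y ∷ rest) → SoleNeighbour G u y
  maximal⇒soleNeighbour acyclic path maximal x ux with maximal x ux
  ... | here refl            = contradiction ux (irrefl G)
  ... | there (here x≡y)     = x≡y
  ... | there (there x∈rest) = contradiction (chord⇒Cycle path x∈rest (sym G ux)) acyclic

LeafAway : (G : Graph) → Fin (n G) → Set
LeafAway G v = ∃₂ λ ℓ s → s ≢ v × SoleNeighbour G ℓ s

-- Extend u w v to a maximal path; its far end is a leaf whose neighbour is not v.
leafAway : ∀ {G} → (∀ u v → Dec (Adj G u v)) → ¬ Cycle G →
  ∀ {u v w} → Adj G v w → Adj G w u → u ≢ v → LeafAway G v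
leafAway {G} adj? acyclic {u} {v} {w} vw wu u≢v
  with extendToMaximal adj? {L = [ w ]} ⊤ (⊂-wellFounded ⊤) (λ _ _ → ∈⊤)
         (IsPath-∷ (sym G wu) (λ { (here refl) → irrefl G wu ; (there (here u≡v)) → u≢v u≡v })
           (IsPath-∷ (sym G vw) (λ { (here refl) → irrefl G vw }) ([-] , [] ∷ [])))
... | u′ , y ∷ zs , path@(_ , _ ∷ y∉ ∷ _) , _ , maximal =
  u′ , y , All.lookup y∉ (∈-++⁺ʳ zs (here refl)) , maximal⇒soleNeighbour acyclic path maximal

Spoke : ∀ {A : Set} → A → A → A → Set
Spoke c x y = (x ≡ c × y ≢ c) ⊎ (x ≢ c × y ≡ c)

Spoke-map : ∀ {A B : Set} {f : A → B} → Injective _≡_ _≡_ f →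
  ∀ {c c′ x y} → f c ≡ c′ → Spoke c x y ⇔ Spoke c′ (f x) (f y)
Spoke-map {f = f} injective refl = mk⇔
  (Sum.map (Product.map (cong f) (_∘ injective)) (Product.map (_∘ injective) (cong f)))
  (Sum.map (Product.map injective (_∘ cong f)) (Product.map (_∘ cong f) injective))

StarAdj⇔Spoke : ∀ {m} (a b : Fin (suc m)) → StarAdj a b ⇔ Spoke zero a b
StarAdj⇔Spoke a b = mk⇔ (to a b) (from a b)
  where
  to : ∀ {m} (a b : Fin (suc m)) → StarAdj a b → Spoke zero a b
  to zero    (suc b) _ = inj₁ (refl , λ ())
  to (suc a) zero    _ = inj₂ ((λ ()) , refl)
  from : ∀ {m} (a b : Fin (suc m)) → Spoke zero a b → StarAdj a b
  from zero    zero    (inj₁ (_ , b≢0)) = b≢0 refl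
  from zero    zero    (inj₂ (a≢0 , _)) = a≢0 refl
  from zero    (suc b) _                = tt
  from (suc a) zero    _                = tt
  from (suc a) (suc b) (inj₁ (() , _))
  from (suc a) (suc b) (inj₂ (_ , ()))

StarCentredAt : (G : Graph) → Fin (n G) → Set
StarCentredAt G c = ∀ x y → Adj G x y ⇔ Spoke c x y

LargeStarAt : (G : Graph) → Fin (n G) → Set
LargeStarAt G c = StarCentredAt G c × ∃₂ λ ℓ ℓ′ → ℓ ≢ c × ℓ′ ≢ c × ℓ ≢ ℓ′

transpose-matchˡ : ∀ {m} (i j : Fin m) → Inverse.to (transpose i j) i ≡ j
transpose-matchˡ i j with i ≟ i
... | yes _   = refl
... | no i≢i = contradiction refl i≢i

starCentredAt⇒≅Star : ∀ {G m c} → n G ≡ suc m → StarCentredAt G c → G ≅ Star m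
starCentredAt⇒≅Star {G@record { n = suc m }} {c = c} refl centred =
  π , λ x y → Equivalence.to (adj⇔star x y) , Equivalence.from (adj⇔star x y)
  where
  π : Fin (suc m) ↔ Fin (suc m)
  π = transpose c zero
  adj⇔star : ∀ x y → Adj G x y ⇔ StarAdj (Inverse.to π x) (Inverse.to π y)
  adj⇔star x y = ⇔-sym (StarAdj⇔Spoke _ _)
    ⇔-∘ (Spoke-map (Injection.injective (↔⇒↣ π)) (transpose-matchˡ c zero) ⇔-∘ centred x y)

≅Star⇒starCentredAt : ∀ {G m} ((f , _) : G ≅ Star m) → StarCentredAt G (Inverse.from f zero)
≅Star⇒starCentredAt (f , iso) x y =
  ⇔-sym (Spoke-map (Injection.injective (↔⇒↣ f)) (Inverse.strictlyInverseˡ f zero))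
    ⇔-∘ (StarAdj⇔Spoke _ _ ⇔-∘ mk⇔ (proj₁ (iso x y)) (proj₂ (iso x y)))

isLargeStar⇒largeStarAt : ∀ {G} → IsLargeStar G → ∃ λ c → LargeStarAt G c
isLargeStar⇒largeStarAt {G} (suc (suc k) , s≤s (s≤s z≤n) , star@(f , _)) =
  from zero , ≅Star⇒starCentredAt {G} star , from (suc zero) , from (suc (suc zero)) ,
  (λ eq → case from-injective eq of λ ()) ,
  (λ eq → case from-injective eq of λ ()) ,
  (λ eq → case from-injective eq of λ ())
  where
  from : Fin (suc (suc (suc k))) → Fin (n G)
  from = Inverse.from f
  from-injective : Injective _≡_ _≡_ from
  from-injective = Injection.injective (↔⇒↣ (↔-sym f))

2≤-of-distinct : ∀ {m} (i j : Fin m) → i ≢ j → 2 ≤ m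
2≤-of-distinct {suc zero}    zero zero i≢j = contradiction refl i≢j
2≤-of-distinct {suc (suc _)} _    _    _   = s≤s (s≤s z≤n)

2≤-of-three-distinct : ∀ {m} {a b c : Fin (suc m)} → a ≢ b → a ≢ c → b ≢ c → 2 ≤ m
2≤-of-three-distinct a≢b a≢c b≢c =
  2≤-of-distinct (punchOut a≢b) (punchOut a≢c) (b≢c ∘ punchOut-injective a≢b a≢c)

largeStarAt⇒IsLargeStar : ∀ {G c} → LargeStarAt G c → IsLargeStar G
largeStarAt⇒IsLargeStar {G@record { n = suc m }} (centred , ℓ , ℓ′ , ℓ≢c , ℓ′≢c , ℓ≢ℓ′) =
  m , 2≤-of-three-distinct (≢-sym ℓ≢c) (≢-sym ℓ′≢c) ℓ≢ℓ′ , starCentredAt⇒≅Star {G} refl centred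

HasIsolatedVertex : Graph → Set
HasIsolatedVertex G = ∃ λ ℓ → ∀ w → ¬ Adj G ℓ w

module _ {G : Graph} (connected : Connected G) where

  pendantNeighbours⇒adjacent : ∀ {v} → (∀ w → Adj G v w → SoleNeighbour G w v) →
    ∀ x → x ≢ v → Adj G v x
  pendantNeighbours⇒adjacent {v} pendant x x≢v with reach (connected v x) (inj₁ refl)
    where
    reach : ∀ {a b} → Walk G a b → a ≡ v ⊎ Adj G v a → b ≡ v ⊎ Adj G v b
    reach here           near        = near
    reach (step ab walk) (inj₁ refl) = reach walk (inj₂ ab)
    reach (step ab walk) (inj₂ va)   = reach walk (inj₁ (pendant _ va _ ab))
  ... | inj₁ x≡v = contradiction x≡v x≢v
  ... | inj₂ vx  = vx

  pendantNeighbours⇒starCentredAt : ∀ {v} → (∀ w → Adj G v w → SoleNeighbour G w v) →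
    StarCentredAt G v
  pendantNeighbours⇒starCentredAt {v} pendant x y = mk⇔ to from
    where
    adjacent : ∀ x → x ≢ v → Adj G v x
    adjacent = pendantNeighbours⇒adjacent pendant
    to : Adj G x y → Spoke v x y
    to xy with x ≟ v
    ... | yes refl = inj₁ (refl , Adj⇒≢ G (sym G xy))
    ... | no x≢v  = inj₂ (x≢v , pendant x (adjacent x x≢v) y xy)
    from : Spoke v x y → Adj G x y
    from (inj₁ (refl , y≢v)) = adjacent y y≢v
    from (inj₂ (x≢v , refl)) = sym G (adjacent x x≢v)

starCentredAt-cases : ∀ {G v} → (∀ u v → Dec (Adj G u v)) → StarCentredAt G v →
  HasIsolatedVertex G ⊎ LeafAway G v ⊎ LargeStarAt G v
starCentredAt-cases {G} {v} adj? centred with any? (adj? v)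
... | no none = inj₁ (v , λ w vw → none (w , vw))
... | yes (w , vw) with any? (λ w′ → adj? v w′ ×-dec ¬? (w′ ≟ w))
...   | no none = inj₂ (inj₁ (v , w , Adj⇒≢ G (sym G vw) ,
          λ w′ vw′ → decidable-stable (w′ ≟ w) (λ w′≢w → none (w′ , vw′ , w′≢w))))
...   | yes (w′ , vw′ , w′≢w) =
          inj₂ (inj₂ (centred , w , w′ , Adj⇒≢ G (sym G vw) , Adj⇒≢ G (sym G vw′) , ≢-sym w′≢w))

module _ {G : Graph} (connected : Connected G) (acyclic : ¬ Cycle G) where

  private
    adj? : ∀ u v → Dec (Adj G u v)
    adj? = acyclic⇒decAdj connected acyclic

  connectedAcyclic-cases : ∀ v → HasIsolatedVertex G ⊎ LeafAway G v ⊎ LargeStarAt G v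
  connectedAcyclic-cases v with any? (λ w → adj? v w ×-dec any? (λ u → adj? w u ×-dec ¬? (u ≟ v)))
  ... | yes (w , vw , u , wu , u≢v) = inj₂ (inj₁ (leafAway adj? acyclic vw wu u≢v))
  ... | no none = starCentredAt-cases {G} adj? (pendantNeighbours⇒starCentredAt connected
          λ w vw u wu → decidable-stable (u ≟ v) (λ u≢v → none (w , vw , u , wu , u≢v)))

Blocked : (G : Graph) → Position G → Fin (n G) → Set
Blocked G p ℓ = ∀ w → Adj G ℓ w → p w ≡ stal

isFree? : (o : Owner) → Dec (o ≡ free)
isFree? free = yes refl
isFree? dom  = no λ ()
isFree? stal = no λ ()

module _ {G : Graph} where

  set-≡ : ∀ (p : Position G) v o → set {G} p v o v ≡ o
  set-≡ p v o with v ≟ v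
  ... | yes _   = refl
  ... | no v≢v = contradiction refl v≢v

  set-≢ : ∀ (p : Position G) {v} o {w} → w ≢ v → set {G} p v o w ≡ p w
  set-≢ p {v} o {w} w≢v with w ≟ v
  ... | yes w≡v = contradiction w≡v w≢v
  ... | no _    = refl

  ¬TotDom-start : Fin (n G) → ¬ TotDom G (start G)
  ¬TotDom-start u td = case proj₂ (proj₂ (td u)) of λ ()

  blocked⇒¬TotDom : ∀ {p ℓ} → Blocked G p ℓ → ¬ TotDom G p
  blocked⇒¬TotDom {ℓ = ℓ} blocked td with td ℓ
  ... | w , ℓw , pw≡dom = case trans (≡.sym pw≡dom) (blocked w ℓw) of λ ()

  blocked-set : ∀ {p ℓ v} o → p v ≡ free → Blocked G p ℓ → Blocked G (set {G} p v o) ℓ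
  blocked-set {v = v} o pv blocked w ℓw with w ≟ v
  ... | yes refl = case trans (≡.sym pv) (blocked w ℓw) of λ ()
  ... | no _     = blocked w ℓw

  claim-free⊆ : ∀ {p v o} {U : Subset (n G)} → o ≢ free →
    (∀ x → p x ≡ free → x Subset.∈ U) → ∀ x → set {G} p v o x ≡ free → x Subset.∈ U - v
  claim-free⊆ {v = v} o≢free free⊆U x with x ≟ v
  ... | yes _   = λ o≡free → contradiction o≡free o≢free
  ... | no x≢v = λ px → x∈p∧x≢y⇒x∈p-y (free⊆U x px) x≢v

  -- U contains every free vertex, so it shrinks strictly with each claim.
  blocked⇒SWins′ : ∀ {p ℓ} pl (U : Subset (n G)) → Acc _⊂_ U →
    (∀ x → p x ≡ free → x Subset.∈ U) → Blocked G p ℓ → SWins G p pl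
  blocked⇒SWins′ {p} pl U (acc smaller) free⊆U blocked = respond pl (any? (isFree? ∘ p))
    where
    ¬td : ¬ TotDom G p
    ¬td = blocked⇒¬TotDom blocked
    afterClaim : ∀ {o} pl′ v → o ≢ free → p v ≡ free → SWins G (set {G} p v o) pl′
    afterClaim pl′ v o≢free pv =
      blocked⇒SWins′ pl′ (U - v) (smaller (x∈p⇒p-x⊂p (free⊆U v pv)))
        (claim-free⊆ o≢free free⊆U) (blocked-set _ pv blocked)
    respond : ∀ pl → Dec (∃ λ v → p v ≡ free) → SWins G p pl
    respond _         (no none)      = over ¬td (λ v pv → none (v , pv))
    respond Staller   (yes (v , pv)) = smove ¬td v pv (afterClaim Dominator v (λ ()) pv)
    respond Dominator (yes freeV)    = dmove ¬td freeV (λ v pv → afterClaim Staller v (λ ()) pv)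

  blocked⇒SWins : ∀ {p ℓ} pl → Blocked G p ℓ → SWins G p pl
  blocked⇒SWins pl = blocked⇒SWins′ pl ⊤ (⊂-wellFounded ⊤) (λ _ _ → ∈⊤)

  claim-soleNeighbour⇒SWins : ∀ {p ℓ s} → p s ≡ free → SoleNeighbour G ℓ s → SWins G p Staller
  claim-soleNeighbour⇒SWins {p} {ℓ} {s} ps sole = smove ¬td s ps (blocked⇒SWins Dominator blocked)
    where
    ¬td : ¬ TotDom G p
    ¬td td with td ℓ
    ... | w , ℓw , pw with sole w ℓw
    ... | refl = case trans (≡.sym pw) ps of λ ()
    blocked : Blocked G (set {G} p s stal) ℓ
    blocked w ℓw rewrite sole w ℓw = set-≡ p s stal

module _ {G : Graph} {c : Fin (n G)} (centred : StarCentredAt G c) where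

  leaf⇒soleNeighbour : ∀ {x} → x ≢ c → SoleNeighbour G x c
  leaf⇒soleNeighbour x≢c w xw with Equivalence.to (centred _ _) xw
  ... | inj₁ (x≡c , _) = contradiction x≡c x≢c
  ... | inj₂ (_ , w≡c) = w≡c

  centre+leaf⇒TotDom : ∀ {p y} → y ≢ c → p c ≡ dom → p y ≡ dom → TotDom G p
  centre+leaf⇒TotDom {y = y} y≢c pc py u with u ≟ c
  ... | yes refl = y , Equivalence.from (centred u y) (inj₁ (refl , y≢c)) , py
  ... | no u≢c  = c , Equivalence.from (centred u c) (inj₂ (u≢c , refl)) , pc

largeStarAt⇒IsN : ∀ {G c} → LargeStarAt G c → IsN G
largeStarAt⇒IsN {G} {c} (centred , ℓ , ℓ′ , ℓ≢c , ℓ′≢c , ℓ≢ℓ′) =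
  dmove c refl (smove (ℓ , set-≢ (start G) dom ℓ≢c) answer) ,
  claim-soleNeighbour⇒SWins {G} refl (leaf⇒soleNeighbour {G} centred ℓ≢c)
  where
  p₀ : Position G
  p₀ = set {G} (start G) c dom
  otherLeaf : ∀ x → ∃ λ y → y ≢ c × y ≢ x
  otherLeaf x with ℓ ≟ x
  ... | yes refl = ℓ′ , ℓ′≢c , ≢-sym ℓ≢ℓ′
  ... | no ℓ≢x  = ℓ , ℓ≢c , ℓ≢x
  answer : ∀ x → p₀ x ≡ free → DWins G (set {G} p₀ x stal) Dominator
  answer x p₀x with otherLeaf x
  ... | y , y≢c , y≢x = dmove y (trans (set-≢ p₀ stal y≢x) (set-≢ (start G) dom y≢c))
    (done (centre+leaf⇒TotDom {G} centred y≢c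
      (trans (set-≢ _ dom (≢-sym y≢c)) (trans (set-≢ p₀ stal c≢x) (set-≡ (start G) c dom)))
      (set-≡ _ y dom)))
    where
    c≢x : c ≢ x
    c≢x refl = case trans (≡.sym p₀x) (set-≡ (start G) c dom) of λ ()

notLargeStar⇒SWins : ∀ {G} → IsTree G → ¬ IsLargeStar G →
  ∀ {p} v → (∀ w → w ≢ v → p w ≡ free) → SWins G p Staller
notLargeStar⇒SWins {G} tree notLarge v othersFree with connectedAcyclic-cases (proj₁ (proj₂ tree)) (proj₂ (proj₂ tree)) v
... | inj₁ (ℓ , isolated)              = blocked⇒SWins Staller (λ w ℓw → contradiction ℓw (isolated w))
... | inj₂ (inj₁ (ℓ , s , s≢v , sole)) = claim-soleNeighbour⇒SWins (othersFree s s≢v) sole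
... | inj₂ (inj₂ large)                = contradiction (largeStarAt⇒IsLargeStar {G} large) notLarge

notLargeStar⇒IsS : ∀ {G} → IsTree G → ¬ IsLargeStar G → IsS G
notLargeStar⇒IsS {G} tree notLarge =
  dmove (¬TotDom-start {G} u₀) (u₀ , refl)
    (λ v _ → notLargeStar⇒SWins tree notLarge v (λ w w≢v → set-≢ (start G) dom w≢v)) ,
  notLargeStar⇒SWins tree notLarge u₀ (λ _ _ → refl)
  where
  u₀ : Fin (n G)
  u₀ = fromℕ< (proj₁ tree)

corollary5p5 : (T : Graph) → IsTree T →
    (IsLargeStar T → IsN T) × (¬ IsLargeStar T → IsS T)
corollary5p5 T tree = largeStarAt⇒IsN {T} ∘ proj₂ ∘ isLargeStar⇒largeStarAt {T} , notLargeStar⇒IsS tree
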